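{- Let $D$ be a deck of order $n$, length $\ell$, with $c$ cards, and let $M=\max_{s\in S}m(s)$ be the highest multiplicity. The following are equivalent: 1. $D$ is $M$-symmetric; 2. $cn=\ell M$; 3. $c=n(M-1)+1$; 4. there exists a card $C$ such that every symbol on $C$ has multiplicity $M$.
   Context: A deck consists of a finite set $S$ of symbols together with a finite collection $D$ of distinct cards, each card being a subset of $S$, satisfying: (D1) any two distinct cards have exactly one symbol in common; (D2) every symbol of $S$ lies on at least two cards; (D3) every card contains at least two symbols; (D4) all cards have the same cardinality $n$ (the order); (D5) $S$ is nonempty. $\ell=|S|$ is the length and $c=|D|$ the number of cards. For $s\in S$, the multiplicity $m(s)$ is the number of cards containing $s$. A deck is $M$-symmetric if every symbol has multiplicity $M$. -}

module Defs where

open import Data.Nat using (ℕ; _≤_; _*_; _+_; _∸_)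
open import Data.Fin using (Fin)
open import Data.Fin.Subset using (Subset; _∈_; _∩_; ∣_∣)
open import Data.Vec using (tabulate; lookup)
open import Data.Product using (∃-syntax; _×_)
open import Relation.Binary.PropositionalEquality using (_≡_; _≢_)
open import Function.Definitions using (Injective)

-- A deck with symbol set S = Fin ℓ (length ℓ), c cards (indexed by Fin c),
-- each card a subset of the symbols, all of cardinality n (the order).
record Deck (ℓ c n : ℕ) : Set where
  field
    card      : Fin c → Subset ℓ
    distinct  : Injective _≡_ _≡_ card
    D1        : ∀ i j → i ≢ j → ∣ card i ∩ card j ∣ ≡ 1
    D2        : ∀ (s : Fin ℓ) → 2 ≤ ∣ tabulate (λ i → lookup (card i) s) ∣
    D3        : ∀ i → 2 ≤ ∣ card i ∣
    D4        : ∀ i → ∣ card i ∣ ≡ n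
    D5        : Fin ℓ                                                      -- S nonempty

open Deck public

-- multiplicity m(s): the number of cards containing s
mult : ∀ {ℓ c n} → Deck ℓ c n → Fin ℓ → ℕ
mult D s = ∣ tabulate (λ i → lookup (card D i) s) ∣

IsMaxMult : ∀ {ℓ c n} → Deck ℓ c n → ℕ → Set
IsMaxMult D M = (∃[ s ] mult D s ≡ M) × (∀ s → mult D s ≤ M)

Symmetric : ∀ {ℓ c n} → Deck ℓ c n → ℕ → Set
Symmetric D M = ∀ s → mult D s ≡ M

-- Count the pairs (symbol s, card C ∋ s) in two ways: once by cards, giving
-- c n = ∑ₛ m(s) ≤ ℓ M with equality iff D is M-symmetric; once restricted to a
-- fixed card C, where (D1) gives ∑_{s ∈ C} m(s) = ∑_{C'} |C ∩ C'| = n + c − 1.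
-- Since ∑_{s ∈ C} m(s) ≤ n M with equality iff every symbol of C has
-- multiplicity M, such a saturated card exists iff c = n (M − 1) + 1, and then
-- every card is saturated; as every symbol lies on a card, D is M-symmetric.
module Submission where

open import Defs
open import Data.Nat.Properties
open import Algebra.Properties.Semiring.Sum +-*-semiring
  using (sum; sum-syntax; sum-cong-≗; sum-remove; ∑-comm; *-distribˡ-sum; *-distribʳ-sum)
open import Data.Bool.Base using (Bool; true; false; _∧_)
open import Data.Fin.Base using (Fin; zero; suc; punchIn)
open import Data.Fin.Properties using (punchInᵢ≢i)
open import Data.Fin.Subset using (Subset; _∈_; _∩_; ∣_∣; Nonempty)
open import Data.Fin.Subset.Properties using (nonempty?; Empty-unique; ∣⊥∣≡0; ∩-idem)
open import Data.Nat.Base using (ℕ; zero; suc; _+_; _*_; _∸_; _≤_; _<_; z≤n)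
open import Data.Product using (∃-syntax; _×_; _,_; proj₁)
open import Data.Vec.Base using ([]; _∷_; lookup; tabulate)
open import Data.Vec.Functional using (Vector)
open import Data.Vec.Properties using (lookup∘tabulate; lookup-zipWith; []=⇒lookup; lookup⇒[]=)
open import Function.Base using (_∘_)
open import Function.Bundles using (_⇔_; mk⇔; Equivalence)
import Function.Properties.Equivalence as ⇔
open import Relation.Nullary.Decidable using (decidable-stable)
open import Relation.Binary.PropositionalEquality

Π⇔ : ∀ {a p q} {I : Set a} {P : I → Set p} {Q : Set q} →
     I → (∀ i → P i ⇔ Q) → (∀ i → P i) ⇔ Q
Π⇔ i₀ P⇔Q = mk⇔ (λ ∀P → Equivalence.to (P⇔Q i₀) (∀P i₀)) (λ q i → Equivalence.from (P⇔Q i) q)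

Σ⇔ : ∀ {a p q} {I : Set a} {P : I → Set p} {Q : Set q} →
     I → (∀ i → P i ⇔ Q) → (∃[ i ] P i) ⇔ Q
Σ⇔ i₀ P⇔Q = mk⇔ (λ (i , p) → Equivalence.to (P⇔Q i) p) (λ q → i₀ , Equivalence.from (P⇔Q i₀) q)

*-pred : ∀ n {m} → 1 ≤ m → n * m ≡ n + n * (m ∸ 1)
*-pred n {suc m} _ = *-suc n m

+1≡+⇒[≡+⇔≡+1] : ∀ {x n c} m → x + 1 ≡ n + c → (x ≡ n + m ⇔ c ≡ m + 1)
+1≡+⇒[≡+⇔≡+1] {x} {n} {c} m x+1≡n+c = mk⇔
  (λ x≡n+m → +-cancelˡ-≡ n c (m + 1) (begin
    n + c       ≡⟨ x+1≡n+c ⟨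
    x + 1       ≡⟨ cong (_+ 1) x≡n+m ⟩
    n + m + 1   ≡⟨ +-assoc n m 1 ⟩
    n + (m + 1) ∎))
  (λ c≡m+1 → +-cancelʳ-≡ 1 x (n + m) (begin
    x + 1       ≡⟨ x+1≡n+c ⟩
    n + c       ≡⟨ cong (n +_) c≡m+1 ⟩
    n + (m + 1) ≡⟨ +-assoc n m 1 ⟨
    n + m + 1   ∎))
  where open ≡-Reasoning

sum-const : ∀ k x → ∑[ i < k ] x ≡ k * x
sum-const zero    x = refl
sum-const (suc k) x = cong (x +_) (sum-const k x)

sum-mono-≤ : ∀ {k} {f g : Vector ℕ k} → (∀ i → f i ≤ g i) → sum f ≤ sum g
sum-mono-≤ {zero}  f≤g = z≤n
sum-mono-≤ {suc k} f≤g = +-mono-≤ (f≤g zero) (sum-mono-≤ (f≤g ∘ suc))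

sum-mono-< : ∀ {k} {f g : Vector ℕ (suc k)} → (∀ j → f j ≤ g j) →
             ∀ {i} → f i < g i → sum f < sum g
sum-mono-< {f = f} {g} f≤g {i} fᵢ<gᵢ = begin-strict
  sum f                     ≡⟨ sum-remove f ⟩
  f i + sum (f ∘ punchIn i) <⟨ +-mono-<-≤ fᵢ<gᵢ (sum-mono-≤ (f≤g ∘ punchIn i)) ⟩
  g i + sum (g ∘ punchIn i) ≡⟨ sum-remove g ⟨
  sum g                     ∎
  where open ≤-Reasoning

sum-≤-≡⇒≗ : ∀ {k} {f g : Vector ℕ k} → (∀ i → f i ≤ g i) → sum f ≡ sum g →
            ∀ i → f i ≡ g i
sum-≤-≡⇒≗ {suc k} f≤g Σf≡Σg i =
  ≤-antisym (f≤g i) (≮⇒≥ (λ fᵢ<gᵢ → <-irrefl Σf≡Σg (sum-mono-< f≤g fᵢ<gᵢ)))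

sum-ones-except : ∀ {k} {f : Vector ℕ k} i → (∀ j → j ≢ i → f j ≡ 1) →
                  sum f + 1 ≡ f i + k
sum-ones-except {suc k} {f} i fⱼ≡1 = begin
  sum f + 1                     ≡⟨ cong (_+ 1) (sum-remove f) ⟩
  f i + sum (f ∘ punchIn i) + 1 ≡⟨ cong (λ t → f i + t + 1) (sum-cong-≗ λ j → fⱼ≡1 (punchIn i j) (punchInᵢ≢i i j)) ⟩
  f i + ∑[ j < k ] 1 + 1        ≡⟨ cong (λ t → f i + t + 1) (trans (sum-const k 1) (*-identityʳ k)) ⟩
  f i + k + 1                   ≡⟨ +-assoc (f i) k 1 ⟩
  f i + (k + 1)                 ≡⟨ cong (f i +_) (+-comm k 1) ⟩
  f i + suc k                   ∎
  where open ≡-Reasoning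

indicator : Bool → ℕ
indicator true  = 1
indicator false = 0

indicator-∧ : ∀ a b → indicator (a ∧ b) ≡ indicator a * indicator b
indicator-∧ true  b = sym (+-identityʳ (indicator b))
indicator-∧ false b = refl

indicator-∈ : ∀ {k} {x : Fin k} {p : Subset k} → x ∈ p → indicator (lookup p x) ≡ 1
indicator-∈ x∈p = cong indicator ([]=⇒lookup x∈p)

∣p∣≡∑indicator : ∀ {k} (p : Subset k) → ∣ p ∣ ≡ ∑[ x < k ] indicator (lookup p x)
∣p∣≡∑indicator []          = refl
∣p∣≡∑indicator (true  ∷ p) = cong suc (∣p∣≡∑indicator p)
∣p∣≡∑indicator (false ∷ p) = ∣p∣≡∑indicator p

∣p∩q∣≡∑indicator* : ∀ {k} (p q : Subset k) →
                    ∣ p ∩ q ∣ ≡ ∑[ x < k ] (indicator (lookup p x) * indicator (lookup q x))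
∣p∩q∣≡∑indicator* p q = trans (∣p∣≡∑indicator (p ∩ q)) (sum-cong-≗ λ x →
  trans (cong indicator (lookup-zipWith _∧_ x p q)) (indicator-∧ (lookup p x) (lookup q x)))

0<∣p∣⇒Nonempty : ∀ {k} (p : Subset k) → 0 < ∣ p ∣ → Nonempty p
0<∣p∣⇒Nonempty {k} p 0<∣p∣ = decidable-stable (nonempty? p) λ empty →
  >⇒≢ 0<∣p∣ (trans (cong ∣_∣ (Empty-unique empty)) (∣⊥∣≡0 k))

module DeckCounting {ℓ c n} (D : Deck ℓ c n) where

  incidence : Fin c → Fin ℓ → ℕ
  incidence i s = indicator (lookup (card D i) s)

  mult≡∑incidence : ∀ s → mult D s ≡ ∑[ i < c ] incidence i s
  mult≡∑incidence s = trans (∣p∣≡∑indicator (tabulate λ i → lookup (card D i) s))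
    (sum-cong-≗ λ i → cong indicator (lookup∘tabulate (λ i → lookup (card D i) s) i))

  ∑mult≡c*n : ∑[ s < ℓ ] mult D s ≡ c * n
  ∑mult≡c*n = begin
    ∑[ s < ℓ ] mult D s                 ≡⟨ sum-cong-≗ mult≡∑incidence ⟩
    ∑[ s < ℓ ] ∑[ i < c ] incidence i s ≡⟨ ∑-comm (λ s i → incidence i s) ⟩
    ∑[ i < c ] ∑[ s < ℓ ] incidence i s ≡⟨ sum-cong-≗ (λ i → trans (sym (∣p∣≡∑indicator (card D i))) (D4 D i)) ⟩
    ∑[ i < c ] n                        ≡⟨ sum-const c n ⟩
    c * n                               ∎
    where open ≡-Reasoning

  on-some-card : ∀ s → ∃[ i ] s ∈ card D i
  on-some-card s with 0<∣p∣⇒Nonempty (tabulate λ i → lookup (card D i) s) (≤-trans (n≤1+n 1) (D2 D s))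
  ... | i , i∈ms = i , lookup⇒[]= s (card D i)
    (trans (sym (lookup∘tabulate (λ i → lookup (card D i) s) i)) ([]=⇒lookup i∈ms))

  weight : Fin c → ℕ
  weight i = ∑[ s < ℓ ] (incidence i s * mult D s)

  weight+1≡n+c : ∀ i → weight i + 1 ≡ n + c
  weight+1≡n+c i = begin
    weight i + 1                                             ≡⟨ cong (_+ 1) weight≡∑∣∩∣ ⟩
    ∑[ j < c ] ∣ card D i ∩ card D j ∣ + 1                  ≡⟨ sum-ones-except i (λ j j≢i → D1 D i j (j≢i ∘ sym)) ⟩
    ∣ card D i ∩ card D i ∣ + c                             ≡⟨ cong (λ p → ∣ p ∣ + c) (∩-idem (card D i)) ⟩
    ∣ card D i ∣ + c                                        ≡⟨ cong (_+ c) (D4 D i) ⟩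
    n + c                                                   ∎
    where
    open ≡-Reasoning
    weight≡∑∣∩∣ : weight i ≡ ∑[ j < c ] ∣ card D i ∩ card D j ∣
    weight≡∑∣∩∣ = begin
      weight i                                                ≡⟨ sum-cong-≗ (λ s → cong (incidence i s *_) (mult≡∑incidence s)) ⟩
      ∑[ s < ℓ ] (incidence i s * ∑[ j < c ] incidence j s)    ≡⟨ sum-cong-≗ (λ s → *-distribˡ-sum (incidence i s) (λ j → incidence j s)) ⟩
      ∑[ s < ℓ ] ∑[ j < c ] (incidence i s * incidence j s)    ≡⟨ ∑-comm (λ s j → incidence i s * incidence j s) ⟩
      ∑[ j < c ] ∑[ s < ℓ ] (incidence i s * incidence j s)    ≡⟨ sum-cong-≗ (λ j → sym (∣p∩q∣≡∑indicator* (card D i) (card D j))) ⟩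
      ∑[ j < c ] ∣ card D i ∩ card D j ∣                      ∎

  Saturated : ℕ → Fin c → Set
  Saturated M i = ∀ s → s ∈ card D i → mult D s ≡ M

  symmetric⇔all-saturated : ∀ {M} → Symmetric D M ⇔ (∀ i → Saturated M i)
  symmetric⇔all-saturated = mk⇔ (λ symm i s _ → symm s)
    (λ sat s → let (i , s∈Cᵢ) = on-some-card s in sat i s s∈Cᵢ)

  module _ {M} (mult≤M : ∀ s → mult D s ≤ M) where

    symmetric⇔c*n≡ℓ*M : Symmetric D M ⇔ (c * n ≡ ℓ * M)
    symmetric⇔c*n≡ℓ*M = mk⇔
      (λ symm → trans (sym ∑mult≡c*n) (trans (sum-cong-≗ symm) (sum-const ℓ M)))
      (λ c*n≡ℓ*M → sum-≤-≡⇒≗ mult≤M (trans ∑mult≡c*n (trans c*n≡ℓ*M (sym (sum-const ℓ M)))))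

    weight≡n*M⇔saturated : ∀ i → weight i ≡ n * M ⇔ Saturated M i
    weight≡n*M⇔saturated i = mk⇔
      (λ weight≡n*M s s∈Cᵢ → *-cancelˡ-≡ (mult D s) M 1
        (subst (λ k → k * mult D s ≡ k * M) (indicator-∈ s∈Cᵢ)
          (sum-≤-≡⇒≗ termwise-≤ (trans weight≡n*M (sym ∑incidence*M≡n*M)) s)))
      (λ sat → trans (sum-cong-≗ (termwise-≡ sat)) ∑incidence*M≡n*M)
      where
      termwise-≤ : ∀ s → incidence i s * mult D s ≤ incidence i s * M
      termwise-≤ s = *-monoʳ-≤ (incidence i s) (mult≤M s)

      termwise-≡ : Saturated M i → ∀ s → incidence i s * mult D s ≡ incidence i s * M
      termwise-≡ sat s with lookup (card D i) s in s∈Cᵢ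
      ... | true  = cong (_+ 0) (sat s (lookup⇒[]= s (card D i) s∈Cᵢ))
      ... | false = refl

      ∑incidence*M≡n*M : ∑[ s < ℓ ] (incidence i s * M) ≡ n * M
      ∑incidence*M≡n*M = begin
        ∑[ s < ℓ ] (incidence i s * M) ≡⟨ *-distribʳ-sum M (incidence i) ⟨
        ∑[ s < ℓ ] incidence i s * M   ≡⟨ cong (_* M) (sym (∣p∣≡∑indicator (card D i))) ⟩
        ∣ card D i ∣ * M               ≡⟨ cong (_* M) (D4 D i) ⟩
        n * M                          ∎
        where open ≡-Reasoning

    saturated⇔c≡n*[M∸1]+1 : 1 ≤ M → ∀ i → Saturated M i ⇔ (c ≡ n * (M ∸ 1) + 1)
    saturated⇔c≡n*[M∸1]+1 1≤M i = ⇔.trans (⇔.sym (weight≡n*M⇔saturated i))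
      (subst (λ k → (weight i ≡ k) ⇔ (c ≡ n * (M ∸ 1) + 1)) (sym (*-pred n 1≤M))
        (+1≡+⇒[≡+⇔≡+1] (n * (M ∸ 1)) (weight+1≡n+c i)))

mainTheorem12 : ∀ {ℓ c n} (D : Deck ℓ c n) (M : ℕ) → IsMaxMult D M →
    (Symmetric D M ⇔ (c * n ≡ ℓ * M))
    × (Symmetric D M ⇔ (c ≡ n * (M ∸ 1) + 1))
    × (Symmetric D M ⇔ (∃[ i ] (∀ (s : Fin ℓ) → s ∈ card D i → mult D s ≡ M)))
mainTheorem12 {c = c} {n} D M ((s₀ , ms₀≡M) , mult≤M) =
    symmetric⇔c*n≡ℓ*M mult≤M
  , symmetric⇔c≡n*[M∸1]+1
  , ⇔.trans symmetric⇔c≡n*[M∸1]+1 (⇔.sym (Σ⇔ i₀ sat⇔c≡))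
  where
  open DeckCounting D
  i₀ : Fin c
  i₀ = proj₁ (on-some-card s₀)
  1≤M : 1 ≤ M
  1≤M = ≤-trans (n≤1+n 1) (subst (2 ≤_) ms₀≡M (D2 D s₀))
  sat⇔c≡ : ∀ i → Saturated M i ⇔ (c ≡ n * (M ∸ 1) + 1)
  sat⇔c≡ = saturated⇔c≡n*[M∸1]+1 mult≤M 1≤M
  symmetric⇔c≡n*[M∸1]+1 : Symmetric D M ⇔ (c ≡ n * (M ∸ 1) + 1)
  symmetric⇔c≡n*[M∸1]+1 = ⇔.trans symmetric⇔all-saturated (Π⇔ i₀ sat⇔c≡)
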